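{- Let $K$ be the bipartite graph with parts $X=\{x_1,x_2,x_3,x_4,x_5,x_4'\}$ and $Y=\{y_1,y_2,y_3,y_4,y_2',y_3'\}$ and edge set $\{x_2y_1,\ x_3y_1,\ x_3y_4,\ x_2y_4,\ x_1y_1,\ x_2y_2,\ x_4y_2,\ x_2y_2',\ x_4'y_2',\ x_3y_3,\ x_5y_3,\ x_3y_3'\}$ (a $4$-cycle $x_2y_1x_3y_4$ with pendant vertex $x_1$ at $y_1$, pendant vertex $y_3'$ at $x_3$, pendant paths $x_3y_3x_5$, $x_2y_2x_4$ and $x_2y_2'x_4'$). Then $K$ is a forbidden induced subgraph for mixed unit interval bigraphs: no mixed unit interval bigraph contains an induced subgraph isomorphic to $K$ (in particular, $K$ itself is not a mixed unit interval bigraph).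
   Context: All graphs are finite and simple. A bigraph $B=(X,Y,E)$ is a bipartite graph with a fixed bipartition $X,Y$. A unit interval is a subset of $\mathbb{R}$ of one of the forms $[a,a+1]$, $(a,a+1)$, $[a,a+1)$, $(a,a+1]$ with $a\in\mathbb{R}$ (closed, open, closed-open, open-closed). A bigraph $B=(X,Y,E)$ is a mixed unit interval bigraph (a $\mathcal{U}$-bigraph) if there is a map $I$ assigning to every vertex $v\in X\cup Y$ a unit interval $I(v)$ (of any of the four types) such that for all $u\in X$ and $v\in Y$, $uv\in E$ if and only if $I(u)\cap I(v)\neq\emptyset$; no condition is imposed on pairs of vertices in the same part. Induced subgraphs of a bigraph inherit the bipartition. -}

module Defs where

open import Level using (0ℓ)
open import Data.Nat using (ℕ)
open import Data.Fin using (Fin; toℕ)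
open import Data.Bool using (Bool; true; false)
open import Data.Product using (Σ; _×_; ∃)
open import Data.Sum using (_⊎_)
open import Relation.Binary.PropositionalEquality using (_≡_)
open import Relation.Binary.Definitions using (Irreflexive; Transitive; Trichotomous)
open import Relation.Nullary using (¬_)
open import Algebra.Structures using (IsCommutativeRing)
open import Function.Bundles using (_⇔_)
open import Function.Definitions using (Injective)

-- Ordered fields (ℝ is an instance; the stdlib has no reals).
-- Equality is propositional equality on the carrier.

record OrderedField : Set₁ where
  infixl 6 _+_
  infixl 7 _*_
  infix  4 _<_ _≤_
  field
    Carrier : Set
    _+_ _*_ : Carrier → Carrier → Carrier
    -_      : Carrier → Carrier
    0# 1#   : Carrier
    _<_     : Carrier → Carrier → Set
    isCommutativeRing : IsCommutativeRing _≡_ _+_ _*_ -_ 0# 1#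
    0≢1     : ¬ (0# ≡ 1#)
    inverse : ∀ x → ¬ (x ≡ 0#) → Σ Carrier (λ y → x * y ≡ 1#)
    <-irrefl : Irreflexive _≡_ _<_
    <-trans  : Transitive _<_
    <-tri    : Trichotomous _≡_ _<_
    +-mono-< : ∀ {a b} c → a < b → a + c < b + c
    *-pos    : ∀ {a b} → 0# < a → 0# < b → 0# < a * b

  _≤_ : Carrier → Carrier → Set
  x ≤ y = (x < y) ⊎ (x ≡ y)

data IntervalType : Set where
  closed opn closedOpen openClosed : IntervalType

module _ (F : OrderedField) where
  open OrderedField F

  record UnitInterval : Set where
    constructor unitInterval
    field
      left : Carrier
      type : IntervalType

  _∈I_ : Carrier → UnitInterval → Set
  x ∈I unitInterval a closed     = (a ≤ x) × (x ≤ a + 1#)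
  x ∈I unitInterval a opn        = (a < x) × (x < a + 1#)
  x ∈I unitInterval a closedOpen = (a ≤ x) × (x < a + 1#)
  x ∈I unitInterval a openClosed = (a < x) × (x ≤ a + 1#)

  Intersect : UnitInterval → UnitInterval → Set
  Intersect I J = ∃ λ x → (x ∈I I) × (x ∈I J)

record Bigraph : Set where
  field
    m n : ℕ
    adj : Fin m → Fin n → Bool

open Bigraph

IsMixedUnitIntervalBigraph : OrderedField → Bigraph → Set
IsMixedUnitIntervalBigraph F B =
  Σ (Fin (m B) → UnitInterval F) λ IX →
  Σ (Fin (n B) → UnitInterval F) λ IY →
  ∀ u v → (adj B u v ≡ true) ⇔ Intersect F (IX u) (IY v)

ContainsInduced : Bigraph → Bigraph → Set
ContainsInduced B H =
  Σ (Fin (m H) → Fin (m B)) λ f →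
  Σ (Fin (n H) → Fin (n B)) λ g →
  Injective _≡_ _≡_ f × Injective _≡_ _≡_ g ×
  (∀ u v → adj B (f u) (g v) ≡ adj H u v)

-- The bigraph K.
-- X indices: 0=x1 1=x2 2=x3 3=x4 4=x5 5=x4'
-- Y indices: 0=y1 1=y2 2=y3 3=y4 4=y2' 5=y3'

K-edge : ℕ → ℕ → Bool
K-edge 1 0 = true
K-edge 2 0 = true
K-edge 2 3 = true
K-edge 1 3 = true
K-edge 0 0 = true
K-edge 1 1 = true
K-edge 3 1 = true
K-edge 1 4 = true
K-edge 5 4 = true
K-edge 2 2 = true
K-edge 4 2 = true
K-edge 2 5 = true
K-edge _ _ = false

K : Bigraph
K = record { m = 6 ; n = 6 ; adj = λ i j → K-edge (toℕ i) (toℕ j) }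

{-# OPTIONS --safe #-}
module Submission where

-- A representation is determined by the left endpoints ℓ of the intervals and by which of
-- their ends are open.  An edge xy says |ℓx − ℓy| ≤ 1, strictly if one of the two ends that
-- must overlap is open; a non-edge says that one interval lies entirely left of the other,
-- ℓx + 1 ≤ ℓy or ℓy + 1 ≤ ℓx, strictly if the two facing ends are closed.  So a
-- representation of a bigraph is a solution, over an ordered field, of a Boolean combination
-- of difference constraints, and a branch fixing the Booleans is infeasible as soon as its
-- constraints contain a cycle of negative weight, or of weight zero through a strict one.
-- A DPLL search over the endpoint types and the sides of the non-edges, which keeps the
-- closure of the constraints in a difference-bound matrix, is proved sound for every
-- bigraph; evaluated on K it closes every branch.  Induced subgraphs of mixed unit
-- interval bigraphs are again mixed unit interval bigraphs, which gives the theorem.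

open import Level using (0ℓ)
open import Data.Bool using (Bool; true; false; T; _∧_; _∨_; not; if_then_else_)
open import Data.Bool.Properties as Boolₚ using (T-∨; T-∧; T-≡)
open import Data.Bool.ListAction using (any)
open import Data.Unit using (tt)
open import Data.Nat as ℕ using (ℕ; zero; suc; _∸_; _⊓_; _<ᵇ_; _≡ᵇ_)
import Data.Nat.Properties as ℕₚ
open import Data.Product using (_×_; _,_; ∃-syntax; proj₁; proj₂; uncurry)
open import Data.Sum as Sum using (_⊎_; inj₁; inj₂; swap; [_,_]′)
open import Data.Empty using (⊥; ⊥-elim)
open import Relation.Nullary using (¬_; does; isYes; yes; no; contradiction)
open import Relation.Binary.PropositionalEquality
  using (_≡_; refl; sym; trans; cong; cong₂; subst; subst₂; module ≡-Reasoning)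
open import Relation.Binary.Definitions using (tri<; tri≈; tri>; DecidableEquality)
open import Relation.Nullary.Decidable using (map′; toWitness)
open import Algebra.Structures using (IsCommutativeRing)
open import Algebra.Bundles using (CommutativeRing)
open import Data.Fin using (Fin; _↑ˡ_; _↑ʳ_; splitAt)
import Data.Fin.Properties as Finₚ
open import Data.Maybe using (Maybe; just; nothing)
import Data.Maybe.Properties as Maybeₚ
open import Data.Maybe.Relation.Unary.All as Maybe using (just; nothing)
open import Data.List
  using (List; []; _∷_; _++_; foldr; foldl; map; concatMap; allFin; filterᵇ; length; cartesianProduct)
open import Data.List.Relation.Unary.All as All using (All; []; _∷_)
open import Data.List.Relation.Unary.All.Properties using (concat⁺; map⁺)
open import Data.List.Relation.Unary.Any.Properties using (any⁻)
open import Data.Vec using (Vec; lookup; tabulate; zipWith) renaming (map to mapᵥ)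
open import Data.Vec.Properties using (lookup∘tabulate; lookup-map; lookup-zipWith)
open import Function.Base using (_$_; _∘_; const; id)
open import Function.Bundles using (Equivalence; _⇔_)
open import Defs

module OrderedFieldProperties (F : OrderedField) where
  open OrderedField F public
  open IsCommutativeRing isCommutativeRing public
    using (+-assoc; +-comm; +-identityˡ; +-identityʳ; -‿inverseˡ; -‿inverseʳ;
           *-assoc; *-identityˡ; *-identityʳ; distribˡ; distribʳ; zeroˡ; zeroʳ)

  commutativeRing : CommutativeRing 0ℓ 0ℓ
  commutativeRing = record { isCommutativeRing = isCommutativeRing }

  open CommutativeRing commutativeRing using (ring; +-monoid; +-commutativeSemigroup)
  open import Algebra.Properties.Ring ring using (-‿distribˡ-*; -‿distribʳ-*; -‿involutive)
  open import Algebra.Properties.CommutativeSemigroup +-commutativeSemigroup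
    using (xy∙z≈xz∙y; xy∙z≈x∙zy; x∙yz≈xz∙y)
  open import Algebra.Properties.Monoid.Mult +-monoid using (×-homo-+) renaming (_×_ to _·_)

  private variable
    x y z c : Carrier
    s t : Bool

  infix 4 _<[_]_
  _<[_]_ : Carrier → Bool → Carrier → Set
  x <[ true ] y = x < y
  x <[ false ] y = x ≤ y

  ≤-refl : x ≤ x
  ≤-refl = inj₂ refl

  <-≤-trans : x < y → y ≤ z → x < z
  <-≤-trans x<y (inj₁ y<z) = <-trans x<y y<z
  <-≤-trans x<y (inj₂ refl) = x<y

  ≤-<-trans : x ≤ y → y < z → x < z
  ≤-<-trans (inj₁ x<y) y<z = <-trans x<y y<z
  ≤-<-trans (inj₂ refl) y<z = y<z

  <⇒<[] : ∀ s → x < y → x <[ s ] y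
  <⇒<[] true x<y = x<y
  <⇒<[] false x<y = inj₁ x<y

  <[]⇒≤ : ∀ s → x <[ s ] y → x ≤ y
  <[]⇒≤ true x<y = inj₁ x<y
  <[]⇒≤ false x≤y = x≤y

  ≤⇒<[] : s ≡ false → x ≤ y → x <[ s ] y
  ≤⇒<[] refl x≤y = x≤y

  ≤-trans : x ≤ y → y ≤ z → x ≤ z
  ≤-trans (inj₁ x<y) y≤z = inj₁ (<-≤-trans x<y y≤z)
  ≤-trans (inj₂ refl) y≤z = y≤z

  <[]-trans : ∀ s t → x <[ s ] y → y <[ t ] z → x <[ s ∨ t ] z
  <[]-trans true t x<y y≤z = <-≤-trans x<y (<[]⇒≤ t y≤z)
  <[]-trans false true x≤y y<z = ≤-<-trans x≤y y<z
  <[]-trans false false x≤y y≤z = ≤-trans x≤y y≤z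

  <[]-weaken : ∀ s t → (T s → T t) → x <[ t ] y → x <[ s ] y
  <[]-weaken true true _ x<y = x<y
  <[]-weaken true false s⇒t _ = ⊥-elim (s⇒t _)
  <[]-weaken false t _ x<y = <[]⇒≤ t x<y

  <[]-total : ∀ s x y → x <[ s ] y ⊎ y <[ not s ] x
  <[]-total s x y with <-tri x y
  <[]-total s x y | tri< x<y _ _ = inj₁ (<⇒<[] s x<y)
  <[]-total true x x | tri≈ _ refl _ = inj₂ ≤-refl
  <[]-total false x x | tri≈ _ refl _ = inj₁ ≤-refl
  <[]-total s x y | tri> _ _ y<x = inj₂ (<⇒<[] (not s) y<x)

  <[]-asym : ∀ s → x <[ s ] y → ¬ (y < x)
  <[]-asym s x≤y y<x = <-irrefl refl (≤-<-trans (<[]⇒≤ s x≤y) y<x)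

  <[]-irrefl : ∀ s → T s → ¬ (x <[ s ] x)
  <[]-irrefl true _ = <-irrefl refl

  <[]-view : ∀ s → x <[ s ] y → x < y ⊎ (x ≡ y × s ≡ false)
  <[]-view true x<y = inj₁ x<y
  <[]-view false (inj₁ x<y) = inj₁ x<y
  <[]-view false (inj₂ x≡y) = inj₂ (x≡y , refl)

  +-monoˡ-<[] : ∀ s c → x <[ s ] y → x + c <[ s ] y + c
  +-monoˡ-<[] true c x<y = +-mono-< c x<y
  +-monoˡ-<[] false c (inj₁ x<y) = inj₁ (+-mono-< c x<y)
  +-monoˡ-<[] false c (inj₂ refl) = ≤-refl

  +-cancelʳ-<[] : ∀ s c → x + c <[ s ] y + c → x <[ s ] y
  +-cancelʳ-<[] {x} {y} s c h = subst₂ (_<[ s ]_) (x+c-c≡x x) (x+c-c≡x y) (+-monoˡ-<[] s (- c) h)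
    where
    x+c-c≡x : ∀ x → x + c + - c ≡ x
    x+c-c≡x x = trans (+-assoc x c (- c)) (trans (cong (x +_) (-‿inverseʳ c)) (+-identityʳ x))

  +-cancelˡ-<[] : ∀ s c → c + x <[ s ] c + y → x <[ s ] y
  +-cancelˡ-<[] {x} {y} s c h = +-cancelʳ-<[] s c (subst₂ (_<[ s ]_) (+-comm c x) (+-comm c y) h)

  <[]-cancel-common : ∀ s {a b c d e} → a + (c + d) <[ s ] b + (c + e) → a + d <[ s ] b + e
  <[]-cancel-common s {a} {b} {c} {d} {e} h =
    +-cancelʳ-<[] s c (subst₂ (_<[ s ]_) (x∙yz≈xz∙y a c d) (x∙yz≈xz∙y b c e) h)

  <[]-chain : ∀ s t {a b c p q p′ q′} → a + p <[ s ] b + q → b + p′ <[ t ] c + q′ →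
              a + (p + p′) <[ s ∨ t ] c + (q + q′)
  <[]-chain s t {a} {b} {c} {p} {q} {p′} {q′} h₁ h₂ =
    subst₂ (_<[ s ∨ t ]_) (+-assoc a p p′) (xy∙z≈x∙zy c q′ q)
      (<[]-trans s t (subst ((a + p) + p′ <[ s ]_) (xy∙z≈xz∙y b q p′) (+-monoˡ-<[] s p′ h₁))
                     (+-monoˡ-<[] t q h₂))

  x<0⇒0<-x : x < 0# → 0# < - x
  x<0⇒0<-x {x} x<0 = subst₂ _<_ (-‿inverseʳ x) (+-identityˡ (- x)) (+-mono-< (- x) x<0)

  0<-x⇒x<0 : 0# < - x → x < 0#
  0<-x⇒x<0 {x} 0<-x = subst₂ _<_ (+-identityˡ x) (-‿inverseˡ x) (+-mono-< x 0<-x)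

  0<1 : 0# < 1#
  0<1 with <-tri 0# 1#
  ... | tri< 0<1 _ _ = 0<1
  ... | tri≈ _ 0≡1 _ = ⊥-elim (0≢1 0≡1)
  ... | tri> _ _ 1<0 =
    ⊥-elim (<-irrefl refl (<-trans 1<0 (subst (0# <_) -1*-1≡1 (*-pos 0<-1 0<-1))))
    where
    0<-1 : 0# < - 1#
    0<-1 = x<0⇒0<-x 1<0
    -1*-1≡1 : - 1# * - 1# ≡ 1#
    -1*-1≡1 = begin
      - 1# * - 1#   ≡⟨ sym (-‿distribˡ-* 1# (- 1#)) ⟩
      - (1# * - 1#) ≡⟨ cong -_ (*-identityˡ (- 1#)) ⟩
      - (- 1#)      ≡⟨ -‿involutive 1# ⟩
      1#            ∎
      where open ≡-Reasoning

  x<x+1 : ∀ x → x < x + 1#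
  x<x+1 x = subst₂ _<_ (+-identityˡ x) (+-comm 1# x) (+-mono-< x 0<1)

  0<a*b⇒0<b : ∀ {a b} → 0# < a → 0# < a * b → 0# < b
  0<a*b⇒0<b {a} {b} 0<a 0<ab with <-tri 0# b
  ... | tri< 0<b _ _ = 0<b
  ... | tri≈ _ refl _ = ⊥-elim (<-irrefl (sym (zeroʳ a)) 0<ab)
  ... | tri> _ _ b<0 = ⊥-elim (<-irrefl refl (<-trans (0<-x⇒x<0 0<-ab) 0<ab))
    where
    0<-ab : 0# < - (a * b)
    0<-ab = subst (0# <_) (sym (-‿distribʳ-* a b)) (*-pos 0<a (x<0⇒0<-x b<0))

  *-monoˡ-< : ∀ {a b} c → 0# < c → a < b → a * c < b * c
  *-monoˡ-< {a} {b} c 0<c a<b = subst₂ _<_ (+-identityˡ (a * c)) difference+ac≡bc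
    (+-mono-< (a * c) (*-pos 0<b-a 0<c))
    where
    0<b-a : 0# < b + - a
    0<b-a = subst (_< b + - a) (-‿inverseʳ a) (+-mono-< (- a) a<b)
    difference+ac≡bc : (b + - a) * c + a * c ≡ b * c
    difference+ac≡bc = begin
      (b + - a) * c + a * c       ≡⟨ cong (_+ a * c) (distribʳ c b (- a)) ⟩
      (b * c + - a * c) + a * c   ≡⟨ +-assoc (b * c) (- a * c) (a * c) ⟩
      b * c + (- a * c + a * c)   ≡⟨ cong (b * c +_) (sym (distribʳ c (- a) a)) ⟩
      b * c + (- a + a) * c       ≡⟨ cong (λ u → b * c + u * c) (-‿inverseˡ a) ⟩
      b * c + 0# * c              ≡⟨ cong (b * c +_) (zeroˡ c) ⟩
      b * c + 0#                  ≡⟨ +-identityʳ (b * c) ⟩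
      b * c                       ∎
      where open ≡-Reasoning

  dense : x < y → ∃[ z ] (x < z × z < y)
  dense {x} {y} x<y =
    (x + y) * half ,
    subst (_< (x + y) * half) (double*half x) (halve (subst (x + x <_) (+-comm y x) (+-mono-< x x<y))) ,
    subst ((x + y) * half <_) (double*half y) (halve (+-mono-< y x<y))
    where
    two : Carrier
    two = 1# + 1#
    0<two : 0# < two
    0<two = <-trans 0<1 (x<x+1 1#)
    two≢0 : ¬ two ≡ 0#
    two≢0 two≡0 = <-irrefl (sym two≡0) 0<two
    half : Carrier
    half = proj₁ (inverse two two≢0)
    two*half≡1 : two * half ≡ 1#
    two*half≡1 = proj₂ (inverse two two≢0)
    0<half : 0# < half
    0<half = 0<a*b⇒0<b 0<two (subst (0# <_) (sym two*half≡1) 0<1)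
    halve : ∀ {a b} → a < b → a * half < b * half
    halve = *-monoˡ-< half 0<half
    double*half : ∀ u → (u + u) * half ≡ u
    double*half u = begin
      (u + u) * half           ≡⟨ cong₂ (λ a b → (a + b) * half) (sym (*-identityʳ u))
                                                                   (sym (*-identityʳ u)) ⟩
      (u * 1# + u * 1#) * half ≡⟨ cong (_* half) (sym (distribˡ u 1# 1#)) ⟩
      u * two * half           ≡⟨ *-assoc u two half ⟩
      u * (two * half)         ≡⟨ cong (u *_) two*half≡1 ⟩
      u * 1#                   ≡⟨ *-identityʳ u ⟩
      u                        ∎
      where open ≡-Reasoning

  ι : ℕ → Carrier
  ι n = n · 1#

  ι-+ : ∀ p q → ι (p ℕ.+ q) ≡ ι p + ι q
  ι-+ p q = ×-homo-+ 1# p q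

  ι-<-suc : ∀ n → ι n < ι (suc n)
  ι-<-suc n = subst (_< 1# + ι n) (+-identityˡ (ι n)) (+-mono-< (ι n) 0<1)

  ι-mono-< : ∀ {p q} → p ℕ.< q → ι p < ι q
  ι-mono-< {p} {suc q} (ℕ.s≤s p≤q) with ℕₚ.m≤n⇒m<n∨m≡n p≤q
  ... | inj₁ p<q = <-trans (ι-mono-< p<q) (ι-<-suc q)
  ... | inj₂ refl = ι-<-suc p

isLeftOpen isRightOpen : IntervalType → Bool
isLeftOpen closed = false
isLeftOpen opn = true
isLeftOpen closedOpen = false
isLeftOpen openClosed = true
isRightOpen closed = false
isRightOpen opn = true
isRightOpen closedOpen = true
isRightOpen openClosed = false

∨≡false : ∀ a b → a ∨ b ≡ false → a ≡ false × b ≡ false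
∨≡false false false refl = refl , refl

module UnitIntervalProperties (F : OrderedField) where
  open OrderedFieldProperties F
  open UnitInterval

  private variable
    x : Carrier
    I J : UnitInterval F

  lo ro : UnitInterval F → Bool
  lo I = isLeftOpen (type I)
  ro I = isRightOpen (type I)

  ∈I⇒bounds : ∀ I → _∈I_ F x I →
              left I <[ lo I ] x × x <[ ro I ] left I + 1#
  ∈I⇒bounds (unitInterval a closed) x∈I = x∈I
  ∈I⇒bounds (unitInterval a opn) x∈I = x∈I
  ∈I⇒bounds (unitInterval a closedOpen) x∈I = x∈I
  ∈I⇒bounds (unitInterval a openClosed) x∈I = x∈I

  bounds⇒∈I : ∀ I → left I <[ lo I ] x → x <[ ro I ] left I + 1# →
              _∈I_ F x I
  bounds⇒∈I (unitInterval a closed) a≤x x≤a+1 = a≤x , x≤a+1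
  bounds⇒∈I (unitInterval a opn) a<x x<a+1 = a<x , x<a+1
  bounds⇒∈I (unitInterval a closedOpen) a≤x x<a+1 = a≤x , x<a+1
  bounds⇒∈I (unitInterval a openClosed) a<x x≤a+1 = a<x , x≤a+1

  Reaches : UnitInterval F → UnitInterval F → Set
  Reaches I J = left I <[ lo I ∨ ro J ] left J + 1#

  Precedes : UnitInterval F → UnitInterval F → Set
  Precedes I J = left I + 1# <[ not (lo J ∨ ro I) ] left J

  intersect-sym : Intersect F I J → Intersect F J I
  intersect-sym (x , x∈I , x∈J) = x , x∈J , x∈I

  intersect⇒reaches : Intersect F I J → Reaches I J
  intersect⇒reaches {I} {J} (x , x∈I , x∈J) =
    <[]-trans (lo I) (ro J) (proj₁ (∈I⇒bounds I x∈I)) (proj₂ (∈I⇒bounds J x∈J))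

  private
    reaches⇒intersect′ : left I ≤ left J → Reaches J I → Intersect F I J
    reaches⇒intersect′ {I} {J} lI≤lJ rJI with <[]-view (lo J ∨ ro I) rJI
    ... | inj₁ lJ<lI+1 with dense lJ<lI+1
    ...   | z , lJ<z , z<lI+1 =
      z , bounds⇒∈I I (<⇒<[] (lo I) (≤-<-trans lI≤lJ lJ<z)) (<⇒<[] (ro I) z<lI+1)
        , bounds⇒∈I J (<⇒<[] (lo J) lJ<z)
                      (<⇒<[] (ro J) (<-≤-trans z<lI+1 (+-monoˡ-<[] false 1# lI≤lJ)))
    reaches⇒intersect′ {I} {J} _ _ | inj₂ (lJ≡lI+1 , closedEnds)
      with ∨≡false (lo J) (ro I) closedEnds
    ... | lJ-closed , rI-closed =
      left J , bounds⇒∈I I (<⇒<[] (lo I) (subst (left I <_) (sym lJ≡lI+1) (x<x+1 (left I))))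
                           (≤⇒<[] rI-closed (inj₂ lJ≡lI+1))
             , bounds⇒∈I J (≤⇒<[] lJ-closed ≤-refl) (<⇒<[] (ro J) (x<x+1 (left J)))

  reaches⇒intersect : Reaches I J → Reaches J I → Intersect F I J
  reaches⇒intersect {I} {J} rIJ rJI with <[]-total false (left I) (left J)
  ... | inj₁ lI≤lJ = reaches⇒intersect′ lI≤lJ rJI
  ... | inj₂ lJ<lI = intersect-sym (reaches⇒intersect′ (inj₁ lJ<lI) rIJ)

  precedes⊎reaches : ∀ I J → Precedes I J ⊎ Reaches J I
  precedes⊎reaches I J = swap (<[]-total (lo J ∨ ro I) (left J) (left I + 1#))

  ¬intersect⇒precedes : ¬ Intersect F I J → Precedes I J ⊎ Precedes J I
  ¬intersect⇒precedes {I} {J} I∩J=∅ with precedes⊎reaches I J | precedes⊎reaches J I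
  ... | inj₁ I≺J | _ = inj₁ I≺J
  ... | inj₂ _ | inj₁ J≺I = inj₂ J≺I
  ... | inj₂ rJI | inj₂ rIJ = ⊥-elim (I∩J=∅ (reaches⇒intersect rIJ rJI))

-- A gap p q s from i to j bounds left endpoints by ℓi + p < ℓj + q (≤ if s is false):
-- offsets on both sides keep all arithmetic in ℕ.
record Gap : Set where
  constructor gap
  field
    lhs rhs : ℕ
    strict  : Bool

_⊕_ : Gap → Gap → Gap
gap p q s ⊕ gap p′ q′ s′ = gap (p ℕ.+ p′) (q ℕ.+ q′) (s ∨ s′)

normalise : Gap → Gap
normalise (gap p q s) = gap (p ∸ q) (q ∸ p) s

_⊕?_ : Maybe Gap → Maybe Gap → Maybe Gap
just g ⊕? just h = just (normalise (g ⊕ h))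
just g ⊕? nothing = nothing
nothing ⊕? _ = nothing

tighter : Gap → Gap → Bool
tighter (gap p q s) (gap p′ q′ s′) =
  (q ℕ.+ p′ <ᵇ q′ ℕ.+ p) ∨ ((q ℕ.+ p′ ≡ᵇ q′ ℕ.+ p) ∧ s)

best : Maybe Gap → Maybe Gap → Maybe Gap
best nothing h = h
best (just g) nothing = just g
best (just g) (just h) = if tighter g h then just g else just h

negative : Maybe Gap → Bool
negative nothing = false
negative (just (gap p q s)) = (q <ᵇ p) ∨ ((q ≡ᵇ p) ∧ s)

DBM : ℕ → Set
DBM k = Vec (Vec (Maybe Gap) k) k

record Constraint (k : ℕ) : Set where
  constructor constraint
  field
    from  : Fin k
    bound : Gap
    to    : Fin k

module _ {k : ℕ} where

  entry : DBM k → Fin k → Fin k → Maybe Gap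
  entry D i j = lookup (lookup D i) j

  diagonal : Fin k → Fin k → Maybe Gap
  diagonal i j = if does (i Finₚ.≟ j) then just (gap 0 0 false) else nothing

  identity : DBM k
  identity = tabulate λ i → tabulate (diagonal i)

  entry-identity : ∀ i j → entry identity i j ≡ diagonal i j
  entry-identity i j =
    trans (cong (λ row → lookup row j) (lookup∘tabulate _ i)) (lookup∘tabulate _ j)

  relaxRow : Maybe Gap → Vec (Maybe Gap) k → Vec (Maybe Gap) k → Vec (Maybe Gap) k
  relaxRow toV fromV row = zipWith best row (mapᵥ (toV ⊕?_) fromV)

  -- One Floyd–Warshall pass through the new edge u → v: it keeps D closed under ⊕, so the
  -- new edge lies on a negative cycle exactly when it does together with entry D v u, which
  -- is what closesCycle checks.
  insert : Constraint k → DBM k → DBM k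
  insert (constraint u g v) D = mapᵥ (λ row → relaxRow (lookup row u ⊕? just g) (lookup D v) row) D

  insertAll : List (Constraint k) → DBM k → DBM k
  insertAll cs D = foldr insert D cs

  entry-insert : ∀ D u g v i j → entry (insert (constraint u g v) D) i j ≡
                                 best (entry D i j) ((entry D i u ⊕? just g) ⊕? entry D v j)
  entry-insert D u g v i j = begin
    lookup (lookup (mapᵥ relax D) i) j
      ≡⟨ cong (λ row → lookup row j) (lookup-map i relax D) ⟩
    lookup (zipWith best (lookup D i) (mapᵥ ((entry D i u ⊕? just g) ⊕?_) (lookup D v))) j
      ≡⟨ lookup-zipWith best j (lookup D i) _ ⟩
    best (entry D i j) (lookup (mapᵥ ((entry D i u ⊕? just g) ⊕?_) (lookup D v)) j)
      ≡⟨ cong (best (entry D i j)) (lookup-map j _ (lookup D v)) ⟩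
    best (entry D i j) ((entry D i u ⊕? just g) ⊕? entry D v j) ∎
    where
    open ≡-Reasoning
    relax : Vec (Maybe Gap) k → Vec (Maybe Gap) k
    relax row = relaxRow (lookup row u ⊕? just g) (lookup D v) row

  closesCycle : DBM k → Constraint k → Bool
  closesCycle D (constraint u g v) = negative (entry D v u ⊕? just g)

module DBMSoundness (F : OrderedField) {k : ℕ} (ρ : Fin k → OrderedField.Carrier F) where
  open OrderedFieldProperties F

  data GapHolds (i j : Fin k) : Gap → Set where
    holds : ∀ {p q s} → ρ i + ι p <[ s ] ρ j + ι q → GapHolds i j (gap p q s)

  ConstraintHolds : Constraint k → Set
  ConstraintHolds (constraint i g j) = GapHolds i j g

  Sound : DBM k → Set
  Sound D = ∀ i j → Maybe.All (GapHolds i j) (entry D i j)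

  private variable
    i j u : Fin k
    D : DBM k

  ⊕-sound : ∀ {g h} → GapHolds i u g → GapHolds u j h → GapHolds i j (g ⊕ h)
  ⊕-sound {i = i} {j = j} (holds {p} {q} {s} g-holds) (holds {p′} {q′} {s′} h-holds) = holds $
    subst₂ (_<[ s ∨ s′ ]_) (cong (ρ i +_) (sym (ι-+ p p′))) (cong (ρ j +_) (sym (ι-+ q q′)))
      (<[]-chain s s′ g-holds h-holds)

  normalise-sound : ∀ {g} → GapHolds i j g → GapHolds i j (normalise g)
  normalise-sound {i = i} {j = j} (holds {p} {q} {s} g-holds) = holds $
    <[]-cancel-common s
      (subst₂ (_<[ s ]_) (cong (ρ i +_) split-p) (cong (ρ j +_) (split p q)) g-holds)
    where
    split : ∀ a b → ι b ≡ ι (a ⊓ b) + ι (b ∸ a)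
    split a b = trans (cong ι (sym (ℕₚ.m⊓n+n∸m≡n a b))) (ι-+ (a ⊓ b) (b ∸ a))
    split-p : ι p ≡ ι (p ⊓ q) + ι (p ∸ q)
    split-p = trans (split q p) (cong (λ c → ι c + ι (p ∸ q)) (ℕₚ.⊓-comm q p))

  ⊕?-sound : ∀ {g? h?} → Maybe.All (GapHolds i u) g? → Maybe.All (GapHolds u j) h? →
             Maybe.All (GapHolds i j) (g? ⊕? h?)
  ⊕?-sound (just g-holds) (just h-holds) = just (normalise-sound (⊕-sound g-holds h-holds))
  ⊕?-sound (just _) nothing = nothing
  ⊕?-sound nothing _ = nothing

  best-preserves : ∀ (P : Maybe Gap → Set) {a b} → P a → P b → P (best a b)
  best-preserves P {nothing} _ Pb = Pb
  best-preserves P {just g} {nothing} Pa _ = Pa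
  best-preserves P {just g} {just h} Pa Pb with tighter g h
  ... | true = Pa
  ... | false = Pb

  negative-sound : ∀ {g?} → Maybe.All (GapHolds i i) g? → ¬ T (negative g?)
  negative-sound nothing ()
  negative-sound {i = i} (just (holds {p} {q} {s} g-holds)) = consistent (+-cancelˡ-<[] s (ρ i) g-holds)
    where
    consistent : ι p <[ s ] ι q → ¬ T ((q <ᵇ p) ∨ ((q ≡ᵇ p) ∧ s))
    consistent ιp<ιq neg with Equivalence.to T-∨ neg
    ... | inj₁ q<p = <[]-asym s ιp<ιq (ι-mono-< (ℕₚ.<ᵇ⇒< q p q<p))
    ... | inj₂ q≡p∧s with Equivalence.to T-∧ q≡p∧s
    ...   | q≡p , strict with ℕₚ.≡ᵇ⇒≡ q p q≡p
    ...     | refl = <[]-irrefl s strict ιp<ιq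

  identity-sound : Sound identity
  identity-sound i j rewrite entry-identity i j with i Finₚ.≟ j
  ... | yes refl = just (holds ≤-refl)
  ... | no _ = nothing

  insert-sound : ∀ {c} → ConstraintHolds c → Sound D → Sound (insert c D)
  insert-sound {D = D} {constraint u g v} c-holds D-sound i j rewrite entry-insert D u g v i j =
    best-preserves (Maybe.All (GapHolds i j)) (D-sound i j)
      (⊕?-sound (⊕?-sound (D-sound i u) (just c-holds)) (D-sound v j))

  insertAll-sound : ∀ {cs} → All ConstraintHolds cs → Sound D → Sound (insertAll cs D)
  insertAll-sound [] D-sound = D-sound
  insertAll-sound {D = D} {c ∷ cs} (c-holds ∷ cs-hold) D-sound =
    insert-sound {D = insertAll cs D} c-holds (insertAll-sound {D = D} cs-hold D-sound)

  closesCycle-sound : ∀ {c} → ConstraintHolds c → Sound D → ¬ T (closesCycle D c)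
  closesCycle-sound {D = D} {constraint u g v} c-holds D-sound =
    negative-sound (⊕?-sound (D-sound v u) (just c-holds))

module Refutation (H : Bigraph) where
  open Bigraph H

  X : Fin m → Fin (m ℕ.+ n)
  X x = x ↑ˡ n

  Y : Fin n → Fin (m ℕ.+ n)
  Y y = m ↑ʳ y

  data Var : Set where
    leftOpen rightOpen : Fin (m ℕ.+ n) → Var
    after : Fin m → Fin n → Var

  _≟_ : DecidableEquality Var
  leftOpen i ≟ leftOpen j = map′ (cong leftOpen) (λ { refl → refl }) (i Finₚ.≟ j)
  rightOpen i ≟ rightOpen j = map′ (cong rightOpen) (λ { refl → refl }) (i Finₚ.≟ j)
  after x y ≟ after x′ y′ with x Finₚ.≟ x′ | y Finₚ.≟ y′
  ... | yes refl | yes refl = yes refl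
  ... | no x≢x′ | _ = no λ { refl → x≢x′ refl }
  ... | yes _ | no y≢y′ = no λ { refl → y≢y′ refl }
  leftOpen _ ≟ rightOpen _ = no λ ()
  leftOpen _ ≟ after _ _ = no λ ()
  rightOpen _ ≟ leftOpen _ = no λ ()
  rightOpen _ ≟ after _ _ = no λ ()
  after _ _ ≟ leftOpen _ = no λ ()
  after _ _ ≟ rightOpen _ = no λ ()

  Assignment : Set
  Assignment = List (Var × Bool)

  value : Assignment → Var → Maybe Bool
  value [] v = nothing
  value ((w , b) ∷ A) v = if does (w ≟ v) then just b else value A v

  known : Assignment → Var → Bool → Bool
  known A v b = isYes (Maybeₚ.≡-dec Boolₚ._≟_ (value A v) (just b))

  reach : Assignment → Fin (m ℕ.+ n) → Fin (m ℕ.+ n) → Constraint (m ℕ.+ n)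
  reach A i j = constraint i (gap 0 1 (known A (leftOpen i) true ∨ known A (rightOpen j) true)) j

  precede : Assignment → Fin (m ℕ.+ n) → Fin (m ℕ.+ n) → Constraint (m ℕ.+ n)
  precede A i j = constraint i (gap 1 0 (known A (leftOpen j) false ∧ known A (rightOpen i) false)) j

  sideConstraints : Assignment → Fin m → Fin n → Maybe Bool → List (Constraint (m ℕ.+ n))
  sideConstraints A x y nothing = []
  sideConstraints A x y (just false) = precede A (X x) (Y y) ∷ []
  sideConstraints A x y (just true) = precede A (Y y) (X x) ∷ []

  pairConstraints : Assignment → Fin m × Fin n → List (Constraint (m ℕ.+ n))
  pairConstraints A (x , y) =
    if adj x y then reach A (X x) (Y y) ∷ reach A (Y y) (X x) ∷ []
    else sideConstraints A x y (value A (after x y))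

  pairsAt : Fin (m ℕ.+ n) → List (Fin m × Fin n)
  pairsAt i = [ (λ x → map (x ,_) (allFin n)) , (λ y → map (_, y) (allFin m)) ]′ (splitAt m i)

  pairsOf : Var → List (Fin m × Fin n)
  pairsOf (leftOpen i) = pairsAt i
  pairsOf (rightOpen i) = pairsAt i
  pairsOf (after x y) = (x , y) ∷ []

  record State : Set where
    constructor state
    field
      assignment : Assignment
      bounds     : DBM (m ℕ.+ n)

  -- A result nothing means that the extended state was found contradictory.
  extend : Assignment → DBM (m ℕ.+ n) → List (Constraint (m ℕ.+ n)) → Maybe State
  extend A D cs = if any (closesCycle D) cs then nothing else just (state A (insertAll cs D))

  assume : State → Var → Bool → Maybe State
  assume (state A D) v b = extend A′ D (concatMap (pairConstraints A′) (pairsOf v))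
    where A′ = (v , b) ∷ A

  forced : State → Maybe State → Maybe State → Maybe State
  forced st nothing nothing = nothing
  forced st nothing (just st₁) = just st₁
  forced st (just st₀) nothing = just st₀
  forced st (just _) (just _) = just st

  -- Failed-literal probing: if one value of v is refuted at once, v takes the other one.
  probe : Maybe State → Var → Maybe State
  probe nothing v = nothing
  probe (just st) v with value (State.assignment st) v
  ... | just _ = just st
  ... | nothing = forced st (assume st v false) (assume st v true)

  variables : List Var
  variables =
    concatMap (λ x → map (after x) (filterᵇ (λ y → not (adj x y)) (allFin n))) (allFin m) ++
    concatMap (λ i → leftOpen i ∷ rightOpen i ∷ []) (allFin (m ℕ.+ n))

  propagate : Maybe State → Maybe State
  propagate mst = foldl probe mst variables

  undecided : Assignment → List Var → Maybe Var
  undecided A [] = nothing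
  undecided A (v ∷ vs) with value A v
  ... | nothing = just v
  ... | just _ = undecided A vs

  -- The fuel bounds the depth of case splits; running out answers false, which is sound.
  refute : ℕ → Maybe State → Bool
  splitOn : ℕ → State → Maybe Var → Bool
  refute _ nothing = true
  refute zero (just _) = false
  refute (suc f) (just st) = splitOn f st (undecided (State.assignment st) variables)
  splitOn f st nothing = false
  splitOn f st (just v) =
    refute f (propagate (assume st v false)) ∧ refute f (propagate (assume st v true))

  allPairs : List (Fin m × Fin n)
  allPairs = cartesianProduct (allFin m) (allFin n)

  initial : State
  initial = state [] (insertAll (concatMap (pairConstraints []) allPairs) identity)

  refutes : Bool
  refutes = refute (length variables) (propagate (just initial))

  module Soundness (F : OrderedField) (I : Fin (m ℕ.+ n) → UnitInterval F)
                   (represents : ∀ x y → (adj x y ≡ true) ⇔ Intersect F (I (X x)) (I (Y y))) where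
    open OrderedFieldProperties F
    open UnitIntervalProperties F
    open DBMSoundness F (λ i → UnitInterval.left (I i))

    Holds : Var → Bool → Set
    Holds (leftOpen i) b = lo (I i) ≡ b
    Holds (rightOpen i) b = ro (I i) ≡ b
    Holds (after x y) false = adj x y ≡ false → Precedes (I (X x)) (I (Y y))
    Holds (after x y) true = adj x y ≡ false → Precedes (I (Y y)) (I (X x))

    holds-total : ∀ v → Holds v false ⊎ Holds v true
    holds-total (leftOpen i) with lo (I i)
    ... | false = inj₁ refl
    ... | true = inj₂ refl
    holds-total (rightOpen i) with ro (I i)
    ... | false = inj₁ refl
    ... | true = inj₂ refl
    holds-total (after x y) with adj x y in xy
    ... | true = inj₁ λ ()
    ... | false = Sum.map const const (¬intersect⇒precedes λ meet →
                    contradiction (trans (sym (Equivalence.from (represents x y) meet)) xy) λ ())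

    Consistent : Assignment → Set
    Consistent = All (uncurry Holds)

    value-sound : ∀ {A v b} → Consistent A → value A v ≡ just b → Holds v b
    value-sound {(w , c) ∷ A} {v} (w≔c ∷ A-holds) eq with w ≟ v
    ... | yes refl = subst (Holds w) (Maybeₚ.just-injective eq) w≔c
    ... | no _ = value-sound A-holds eq

    known-sound : ∀ {A v b} → Consistent A → T (known A v b) → Holds v b
    known-sound {A} {v} {b} A-holds v≔b =
      value-sound A-holds (toWitness {a? = Maybeₚ.≡-dec Boolₚ._≟_ (value A v) (just b)} v≔b)

    reach-sound : ∀ {A i j} → Consistent A → Intersect F (I i) (I j) →
                  ConstraintHolds (reach A i j)
    reach-sound {A} {i} {j} A-holds meet = holds $
      subst₂ (_<[ s ]_) (sym (+-identityʳ _)) (cong (_ +_) (sym (+-identityʳ 1#)))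
        (<[]-weaken s (lo (I i) ∨ ro (I j)) strict⇒open (intersect⇒reaches meet))
      where
      s = known A (leftOpen i) true ∨ known A (rightOpen j) true
      strict⇒open : T s → T (lo (I i) ∨ ro (I j))
      strict⇒open t = Equivalence.from T-∨ (Sum.map
        (λ t → Equivalence.from T-≡ (known-sound {v = leftOpen i} A-holds t))
        (λ t → Equivalence.from T-≡ (known-sound {v = rightOpen j} A-holds t))
        (Equivalence.to T-∨ t))

    precede-sound : ∀ {A i j} → Consistent A → Precedes (I i) (I j) →
                    ConstraintHolds (precede A i j)
    precede-sound {A} {i} {j} A-holds i≺j = holds $
      subst₂ (_<[ s ]_) (cong (_ +_) (sym (+-identityʳ 1#))) (sym (+-identityʳ _))
        (<[]-weaken s (not (lo (I j) ∨ ro (I i))) strict⇒closed i≺j)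
      where
      s = known A (leftOpen j) false ∧ known A (rightOpen i) false
      strict⇒closed : T s → T (not (lo (I j) ∨ ro (I i)))
      strict⇒closed t with Equivalence.to T-∧ t
      ... | tj , ti rewrite known-sound {v = leftOpen j} A-holds tj
                          | known-sound {v = rightOpen i} A-holds ti = tt

    pairConstraints-sound : ∀ {A} → Consistent A → ∀ xy →
                            All ConstraintHolds (pairConstraints A xy)
    pairConstraints-sound {A} A-holds (x , y) with adj x y in xy
    ... | true = reach-sound A-holds meet ∷ reach-sound A-holds (intersect-sym meet) ∷ []
      where meet = Equivalence.to (represents x y) xy
    ... | false with value A (after x y) in x≔
    ...   | nothing = []
    ...   | just false = precede-sound A-holds (value-sound A-holds x≔ xy) ∷ []
    ...   | just true = precede-sound A-holds (value-sound A-holds x≔ xy) ∷ []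

    constraints-sound : ∀ {A} → Consistent A → ∀ ps →
                        All ConstraintHolds (concatMap (pairConstraints A) ps)
    constraints-sound A-holds ps = concat⁺ (map⁺ (All.universal (pairConstraints-sound A-holds) ps))

    Valid : State → Set
    Valid (state A D) = Consistent A × Sound D

    Valid? : Maybe State → Set
    Valid? nothing = ⊥
    Valid? (just st) = Valid st

    extend-sound : ∀ {A D cs} → Consistent A → Sound D → All ConstraintHolds cs →
                   Valid? (extend A D cs)
    extend-sound {A} {D} {cs} A-holds D-sound cs-hold with any (closesCycle D) cs in conflict
    ... | true = closesCycle-sound {D = D} c-holds D-sound closes
      where
      cycle = any⁻ (closesCycle D) cs (subst T (sym conflict) tt)
      c-holds = proj₁ (All.lookupAny cs-hold cycle)
      closes = proj₂ (All.lookupAny cs-hold cycle)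
    ... | false = A-holds , insertAll-sound {D = D} cs-hold D-sound

    assume-sound : ∀ {st v b} → Valid st → Holds v b → Valid? (assume st v b)
    assume-sound {state A D} {v} (A-holds , D-sound) v≔b =
      extend-sound (v≔b ∷ A-holds) D-sound (constraints-sound (v≔b ∷ A-holds) (pairsOf v))

    forced-sound : ∀ {st a b} → Valid st → Valid? a ⊎ Valid? b → Valid? (forced st a b)
    forced-sound {a = nothing} {nothing} _ = [ id , id ]′
    forced-sound {a = nothing} {just _} _ = [ ⊥-elim , id ]′
    forced-sound {a = just _} {nothing} _ = [ id , ⊥-elim ]′
    forced-sound {a = just _} {just _} st-valid _ = st-valid

    probe-sound : ∀ {mst} v → Valid? mst → Valid? (probe mst v)
    probe-sound {just st} v st-valid with value (State.assignment st) v
    ... | just _ = st-valid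
    ... | nothing = forced-sound st-valid
                      (Sum.map (assume-sound {st} st-valid) (assume-sound {st} st-valid) (holds-total v))

    propagate-sound : ∀ {mst} → Valid? mst → Valid? (propagate mst)
    propagate-sound = go variables
      where
      go : ∀ {mst} vs → Valid? mst → Valid? (foldl probe mst vs)
      go [] valid = valid
      go (v ∷ vs) valid = go vs (probe-sound v valid)

    refute-sound : ∀ f mst → Valid? mst → ¬ T (refute f mst)
    splitOn-sound : ∀ f st → Valid st → ∀ mv → ¬ T (splitOn f st mv)
    refute-sound _ nothing ()
    refute-sound zero (just st) _ ()
    refute-sound (suc f) (just st) st-valid =
      splitOn-sound f st st-valid (undecided (State.assignment st) variables)
    splitOn-sound f st st-valid nothing ()
    splitOn-sound f st st-valid (just v) t with Equivalence.to T-∧ t | holds-total v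
    ... | refuted₀ , _ | inj₁ v≔0 =
      refute-sound f _ (propagate-sound (assume-sound {st} st-valid v≔0)) refuted₀
    ... | _ , refuted₁ | inj₂ v≔1 =
      refute-sound f _ (propagate-sound (assume-sound {st} st-valid v≔1)) refuted₁

    initial-valid : Valid initial
    initial-valid = [] , insertAll-sound (constraints-sound [] allPairs) identity-sound

    refutes-sound : refutes ≡ true → ⊥
    refutes-sound r =
      refute-sound _ _ (propagate-sound {just initial} initial-valid) (subst T (sym r) tt)

refutes⇒¬mixed : ∀ F H → Refutation.refutes H ≡ true → ¬ IsMixedUnitIntervalBigraph F H
refutes⇒¬mixed F H refuted (IX , IY , represents) = refutes-sound refuted
  where
  open Bigraph H
  open Refutation H using (X; Y; module Soundness)
  I : Fin (m ℕ.+ n) → UnitInterval F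
  I i = [ IX , IY ]′ (splitAt m i)
  represents′ : ∀ x y → (adj x y ≡ true) ⇔ Intersect F (I (X x)) (I (Y y))
  represents′ x y rewrite Finₚ.splitAt-↑ˡ m x n | Finₚ.splitAt-↑ʳ m n y = represents x y
  open Soundness F I represents′ using (refutes-sound)

induced-mixed : ∀ {F B H} → IsMixedUnitIntervalBigraph F B → ContainsInduced B H →
                IsMixedUnitIntervalBigraph F H
induced-mixed (IX , IY , represents) (f , g , _ , _ , adj-preserved) =
  IX ∘ f , IY ∘ g ,
  λ u v → subst (λ b → (b ≡ true) ⇔ _) (adj-preserved u v) (represents (f u) (g v))

lemma10 : (F : OrderedField) (B : Bigraph) →
          IsMixedUnitIntervalBigraph F B → ¬ ContainsInduced B K
lemma10 F B B-mixed K⊆B = refutes⇒¬mixed F K refl (induced-mixed B-mixed K⊆B)
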